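{- Let $G=(V,E)$ be a directed graph with positive edge weights and let $d>0$ be an even integer. Let $H\subseteq V$. Let $\mathcal{T}^{\mathrm{from}}=\{T^{\mathrm{from}}_v: v\in H\}$ (respectively $\mathcal{T}^{\mathrm{to}}=\{T^{\mathrm{to}}_v: v\in H\}$) be a collection of $(1+\epsilon)$-approximate shortest path trees up to depth $3d$ from the vertices of $H$ in $G$ (respectively in the reverse graph $\overleftarrow{G}$). Let $B\subseteq V$ be a $(\mathcal{T}^{\mathrm{from}}\cup \mathcal{T}^{\mathrm{to}},\frac{d}{2})$-blocker set. Then for any $u\to v$ path $P$ in $G$ that is $(H,d)$-covered and any integer $j\geq 0$ with $|P|\leq 2^jd$, there exists a $u\to v$ path $P'$ in $G$ such that $\ell(P')\leq (1+\epsilon)^j\cdot \ell(P)$ and $P'$ is $(B,2d(j+1))$-covered.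
   Context: $\overleftarrow{G}$ reverses every edge keeping weights. $\ell(P)$ is the sum of edge weights of $P$, $|P|$ its number of edges; $\delta^k_G(u,v)$ is the minimum length of a $u\to v$ path with at most $k$ edges. An out-tree $T\subseteq G$ rooted at $s$ is a $(1+\epsilon)$-approximate shortest path tree from $s$ up to depth $k$ if for every $v$ with $\delta^{k}_G(s,v)<\infty$, $v\in V(T)$ and $\delta_T(s,v)\le(1+\epsilon)\delta^{k}_G(s,v)$. For a rooted tree $T$ (any depth) and integer $k>0$, $B$ is a $(T,k)$-blocker set if for every non-leaf $x\in V(T)$ with depth divisible by $k$ and every descendant $y$ of $x$ at depth $\mathrm{depth}(x)+k$, some vertex of the tree path from $x$ to $y$ (inclusive) is in $B$; for a collection of trees this must hold for each tree. A path is $(B,k)$-covered if it equals $P_1\cdots P_r$ with $P_i$ a $u_i\to v_i$ path with at most $k$ edges and $u_i\in B$ for $i\ge2$.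
   Formalization: The edge weights of G and the parameter ε are rational numbers rather than real numbers. -}

module Defs where

open import Data.Nat as ℕ using (ℕ; zero; suc)
open import Data.Nat.Divisibility using (_∣_)
open import Data.Fin using (Fin)
open import Data.Bool using (Bool; true)
open import Data.Rational as ℚ using (ℚ; 0ℚ; 1ℚ)
open import Data.Product using (Σ; ∃; _×_; _,_)
open import Relation.Binary.PropositionalEquality using (_≡_; _≢_)

_^ℚ_ : ℚ → ℕ → ℚ
q ^ℚ zero  = 1ℚ
q ^ℚ suc j = q ℚ.* (q ^ℚ j)

record Graph : Set where
  field
    n   : ℕ
    adj : Fin n → Fin n → Bool
    w   : Fin n → Fin n → ℚ
open Graph public

V : Graph → Set
V G = Fin (n G)

PositiveWeights : Graph → Set
PositiveWeights G = ∀ u v → adj G u v ≡ true → 0ℚ ℚ.< w G u v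

rev : Graph → Graph
rev G = record { n = n G ; adj = λ u v → adj G v u ; w = λ u v → w G v u }

data Walk (G : Graph) : V G → V G → Set where
  nil  : ∀ {u} → Walk G u u
  cons : ∀ {u x v} → adj G u x ≡ true → Walk G x v → Walk G u v

ℓ : ∀ {G u v} → Walk G u v → ℚ
ℓ nil = 0ℚ
ℓ {G} {u} (cons {x = x} _ P) = w G u x ℚ.+ ℓ P

len : ∀ {G u v} → Walk G u v → ℕ
len nil = 0
len (cons _ P) = suc (len P)

_++_ : ∀ {G u x v} → Walk G u x → Walk G x v → Walk G u v
nil ++ Q = Q
cons e P ++ Q = cons e (P ++ Q)

-- (B,k)-covered: P = P₁ ⋯ P_r, each P_i with ≤ k edges, start of P_i in B for i ≥ 2
data Covered {G : Graph} (B : V G → Set) (k : ℕ) : ∀ {u v} → Walk G u v → Set where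
  single : ∀ {u v} (P : Walk G u v) → len P ℕ.≤ k → Covered B k P
  split  : ∀ {u x v} (P₁ : Walk G u x) (P₂ : Walk G x v) →
           len P₁ ℕ.≤ k → B x → Covered B k P₂ → Covered B k (P₁ ++ P₂)

IsDistK : (G : Graph) → ℕ → V G → V G → ℚ → Set
IsDistK G k s v d =
  (Σ (Walk G s v) λ P → len P ℕ.≤ k × ℓ P ≡ d) ×
  (∀ (P : Walk G s v) → len P ℕ.≤ k → d ℚ.≤ ℓ P)

record Tree (G : Graph) (s : V G) : Set₁ where
  field
    inT        : V G → Set
    parent     : V G → V G
    depth      : V G → ℕ
    root-in    : inT s
    root-depth : depth s ≡ 0
    nonroot    : ∀ x → inT x → x ≢ s →
                 inT (parent x) × adj G (parent x) x ≡ true × depth x ≡ suc (depth (parent x))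
open Tree public

anc : ∀ {G s} → Tree G s → ℕ → V G → V G
anc T zero x = x
anc T (suc i) x = anc T i (parent T x)

tdist : ∀ {G s} → Tree G s → ℕ → V G → ℚ
tdist {G} T zero x = 0ℚ
tdist {G} T (suc i) x = w G (parent T x) x ℚ.+ tdist T i (parent T x)

δT : ∀ {G s} → Tree G s → V G → ℚ
δT T v = tdist T (depth T v) v

ApproxSPT : (G : Graph) (ε : ℚ) (k : ℕ) (s : V G) → Tree G s → Set
ApproxSPT G ε k s T = ∀ v d → IsDistK G k s v d →
  inT T v × δT T v ℚ.≤ (1ℚ ℚ.+ ε) ℚ.* d

Blocker : ∀ {G s} → Tree G s → ℕ → (V G → Set) → Set
Blocker T k B = ∀ x → inT T x → NonLeaf x → k ∣ depth T x →
  ∀ y → inT T y → depth T y ≡ depth T x ℕ.+ k → anc T k y ≡ x →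
  ∃ λ i → i ℕ.≤ k × B (anc T i y)
  where
  NonLeaf : _ → Set
  NonLeaf x = ∃ λ c → inT T c × parent T c ≡ x × depth T c ≡ suc (depth T x)

module Submission where

-- Induction on j, sweeping P from left to right while keeping a processed prefix S, which ends
-- at a vertex x of H, and the rest R of P. Cut off the next piece Q of R with 2d ≤ |Q| ≤ 3d edges
-- ending in H (or all of R if it is that short) and replace it by the path to its endpoint in
-- the (1+ε)-approximate shortest path tree from x, which costs at most (1+ε)ℓ(Q). If that tree
-- path has fewer than d/2 edges it is appended to S and the sweep goes on. Otherwise the blocker
-- property, applied at the depths divisible by d/2, splits it into a head of at most d/2 edges
-- ending in B, a (B,d)-covered middle, and a tail of at most d edges starting in B. By induction
-- S·head is replaced at stretch (1+ε)^(j-1) by a (B,2dj)-covered path, which ends in B; the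
-- middle is kept and the sweep restarts with the tail as prefix. Every short replacement adds
-- fewer than d/2 edges to S while consuming at least 2d edges of R, so S·head never has more
-- than 2^(j-1)d edges.

open import Defs
open import Data.Nat as ℕ
  using (ℕ; zero; suc; _+_; _*_; _^_; _∸_; _/_; _%_; _≤_; _<_; _≤?_; z≤n; s≤s; NonZero)
import Data.Nat.Properties as ℕₚ
open import Data.Nat.DivMod using (m≡m%n+[m/n]*n; m%n<n; m≥n⇒m/n>0; m/n*n≡m)
open import Data.Nat.Divisibility using (_∣_; divides)
open import Data.Nat.Tactic.RingSolver using (solve-∀)
open import Data.Rational as ℚ using (ℚ; 0ℚ; 1ℚ)
import Data.Rational.Properties as ℚₚ
open import Data.Bool as Bool using (Bool; true; false)
open import Data.Fin using (_≟_)
open import Data.Product using (Σ; Σ-syntax; ∃-syntax; _×_; _,_; proj₁; proj₂)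
open import Data.Sum using (inj₁; inj₂)
open import Data.List as List using (List; []; _∷_; allFin; concatMap)
open import Data.List.Relation.Unary.All as All using (All; []; _∷_)
import Data.List.Relation.Unary.All.Properties as Allₚ
import Data.List.Relation.Unary.Any as Any
open import Data.List.Membership.Propositional using (_∈_; lose)
open import Data.List.Membership.Propositional.Properties
  using (∈-map⁺; ∈-++⁺ˡ; ∈-++⁺ʳ; ∈-concatMap⁺; ∈-allFin)
open import Relation.Binary.Bundles using (DecTotalOrder)
open import Data.List.Extrema (DecTotalOrder.totalOrder ℚₚ.≤-decTotalOrder)
  using (argmin; argmin-all; f[argmin]≤v⁺)
open import Axiom.UniquenessOfIdentityProofs using (module Decidable⇒UIP)
open import Function using (case_of_)
open import Relation.Nullary using (yes; no; contradiction)
open import Relation.Binary.PropositionalEquality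

len-++ : ∀ {G a b c} (P : Walk G a b) (Q : Walk G b c) → len (P ++ Q) ≡ len P + len Q
len-++ nil        Q = refl
len-++ (cons e P) Q = cong suc (len-++ P Q)

ℓ-++ : ∀ {G a b c} (P : Walk G a b) (Q : Walk G b c) → ℓ (P ++ Q) ≡ ℓ P ℚ.+ ℓ Q
ℓ-++ nil Q = sym (ℚₚ.+-identityˡ (ℓ Q))
ℓ-++ {G} {a} (cons {x = x} e P) Q =
  trans (cong (w G a x ℚ.+_) (ℓ-++ P Q)) (sym (ℚₚ.+-assoc (w G a x) (ℓ P) (ℓ Q)))

++-assoc : ∀ {G a b c d} (P : Walk G a b) (Q : Walk G b c) (R : Walk G c d) →
           (P ++ Q) ++ R ≡ P ++ (Q ++ R)
++-assoc nil        Q R = refl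
++-assoc (cons e P) Q R = cong (cons e) (++-assoc P Q R)

0≤ℓ : ∀ {G} → PositiveWeights G → ∀ {a b} (P : Walk G a b) → 0ℚ ℚ.≤ ℓ P
0≤ℓ pw nil        = ℚₚ.≤-refl
0≤ℓ pw (cons e P) = ℚₚ.+-mono-≤ (ℚₚ.<⇒≤ (pw _ _ e)) (0≤ℓ pw P)

record SizedWalk (G : Graph) (a b : V G) (n : ℕ) (l : ℚ) : Set where
  field
    walk   : Walk G a b
    |walk| : len walk ≡ n
    ℓ-walk : ℓ walk ≡ l

module _ {G : Graph} {B : V G → Set} where

  Covered-++ : ∀ {k a b c} {X : Walk G a b} {Y : Walk G b c} →
               Covered B k X → B b → Covered B k Y → Covered B k (X ++ Y)
  Covered-++ {Y = Y} (single X |X|≤k) b∈B cY = split X Y |X|≤k b∈B cY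
  Covered-++ {Y = Y} (split P₁ P₂ |P₁|≤k x∈B cP₂) b∈B cY =
    subst (Covered B _) (sym (++-assoc P₁ P₂ Y)) (split P₁ (P₂ ++ Y) |P₁|≤k x∈B (Covered-++ cP₂ b∈B cY))

  Covered-mono : ∀ {k k′ a b} {X : Walk G a b} → k ≤ k′ → Covered B k X → Covered B k′ X
  Covered-mono k≤k′ (single P |P|≤k) = single P (ℕₚ.≤-trans |P|≤k k≤k′)
  Covered-mono k≤k′ (split P₁ P₂ |P₁|≤k x∈B cP₂) =
    split P₁ P₂ (ℕₚ.≤-trans |P₁|≤k k≤k′) x∈B (Covered-mono k≤k′ cP₂)

*-monoˡ-≤-0≤ : ∀ {r p q} → 0ℚ ℚ.≤ r → p ℚ.≤ q → r ℚ.* p ℚ.≤ r ℚ.* q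
*-monoˡ-≤-0≤ {r} 0≤r = ℚₚ.*-monoˡ-≤-nonNeg r {{ℚ.nonNegative 0≤r}}

p≤q*p : ∀ {p q} → 1ℚ ℚ.≤ q → 0ℚ ℚ.≤ p → p ℚ.≤ q ℚ.* p
p≤q*p {p} 1≤q 0≤p = ℚₚ.≤-trans (ℚₚ.≤-reflexive (sym (ℚₚ.*-identityˡ p)))
  (ℚₚ.*-monoʳ-≤-nonNeg p {{ℚ.nonNegative 0≤p}} 1≤q)

1≤q^ℚn : ∀ {q} → 1ℚ ℚ.≤ q → ∀ n → 1ℚ ℚ.≤ q ^ℚ n
1≤q^ℚn 1≤q zero    = ℚₚ.≤-refl
1≤q^ℚn 1≤q (suc n) = ℚₚ.≤-trans (1≤q^ℚn 1≤q n)
  (p≤q*p 1≤q (ℚₚ.≤-trans (ℚₚ.<⇒≤ (ℚₚ.positive⁻¹ 1ℚ)) (1≤q^ℚn 1≤q n)))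

scale-≤ : ∀ {c α t q} → 0ℚ ℚ.≤ α → t ℚ.≤ c ℚ.* q → α ℚ.* t ℚ.≤ (c ℚ.* α) ℚ.* q
scale-≤ {c} {α} {t} {q} 0≤α t≤cq = ℚₚ.≤-trans (*-monoˡ-≤-0≤ 0≤α t≤cq)
  (ℚₚ.≤-reflexive (trans (sym (ℚₚ.*-assoc α c q)) (cong (ℚ._* q) (ℚₚ.*-comm α c))))

*-collect : ∀ α x y r → α ℚ.* x ℚ.+ (α ℚ.* y ℚ.+ r) ≡ α ℚ.* (x ℚ.+ y) ℚ.+ r
*-collect α x y r =
  trans (sym (ℚₚ.+-assoc (α ℚ.* x) _ r)) (cong (ℚ._+ r) (sym (ℚₚ.*-distribˡ-+ α x y)))

+-*-collect : ∀ a b q r → a ℚ.+ b ℚ.* q ℚ.+ b ℚ.* r ≡ a ℚ.+ b ℚ.* (q ℚ.+ r)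
+-*-collect a b q r = trans (ℚₚ.+-assoc a _ _) (cong (a ℚ.+_) (sym (ℚₚ.*-distribˡ-+ b q r)))

absorb-≤ : ∀ {c α s r} → 1ℚ ℚ.≤ c → 0ℚ ℚ.≤ α → 0ℚ ℚ.≤ s →
           α ℚ.* s ℚ.+ (c ℚ.* α) ℚ.* r ℚ.≤ (c ℚ.* α) ℚ.* (s ℚ.+ r)
absorb-≤ {c} {α} {s} {r} 1≤c 0≤α 0≤s = begin
  α ℚ.* s ℚ.+ (c ℚ.* α) ℚ.* r
    ≤⟨ ℚₚ.+-monoˡ-≤ ((c ℚ.* α) ℚ.* r) (ℚₚ.*-monoʳ-≤-nonNeg s {{ℚ.nonNegative 0≤s}} (p≤q*p 1≤c 0≤α)) ⟩
  (c ℚ.* α) ℚ.* s ℚ.+ (c ℚ.* α) ℚ.* r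
    ≡⟨ ℚₚ.*-distribˡ-+ (c ℚ.* α) s r ⟨
  (c ℚ.* α) ℚ.* (s ℚ.+ r) ∎
  where open ℚₚ.≤-Reasoning

module _ (G : Graph) where

  trivialWalks : ∀ s t → List (Walk G s t)
  trivialWalks s t with s ≟ t
  ... | yes refl = nil ∷ []
  ... | no _     = []

  extendBy : ∀ {s t} x (b : Bool) → adj G s x ≡ b → List (Walk G x t) → List (Walk G s t)
  extendBy x true  e ws = List.map (cons e) ws
  extendBy x false _ _  = []

  walksUpTo : ℕ → ∀ s t → List (Walk G s t)
  walksUpTo zero    s t = trivialWalks s t
  walksUpTo (suc K) s t = trivialWalks s t List.++
    concatMap (λ x → extendBy x (adj G s x) refl (walksUpTo K x t)) (allFin (n G))

  trivialWalks-sound : ∀ K s t → All (λ W → len W ≤ K) (trivialWalks s t)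
  trivialWalks-sound K s t with s ≟ t
  ... | yes refl = z≤n ∷ []
  ... | no _     = []

  extendBy-sound : ∀ {K s t} x b (e : adj G s x ≡ b) {ws : List (Walk G x t)} →
                   All (λ W → len W ≤ K) ws → All (λ W → len W ≤ suc K) (extendBy x b e ws)
  extendBy-sound x true  e sound = Allₚ.map⁺ (All.map s≤s sound)
  extendBy-sound x false e _     = []

  walksUpTo-sound : ∀ K s t → All (λ W → len W ≤ K) (walksUpTo K s t)
  walksUpTo-sound zero    s t = trivialWalks-sound 0 s t
  walksUpTo-sound (suc K) s t = Allₚ.++⁺ (trivialWalks-sound (suc K) s t)
    (Allₚ.concat⁺ (Allₚ.map⁺ (All.universal (λ x → extendBy-sound x _ refl (walksUpTo-sound K x t))
                                            (allFin (n G)))))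

  nil∈trivialWalks : ∀ s → nil ∈ trivialWalks s s
  nil∈trivialWalks s with s ≟ s
  ... | yes refl = Any.here refl
  ... | no s≢s   = contradiction refl s≢s

  ∈-extendBy : ∀ {s t} x b (e′ : adj G s x ≡ b) (e : adj G s x ≡ true) {P : Walk G x t} {ws} →
               P ∈ ws → cons e P ∈ extendBy x b e′ ws
  ∈-extendBy x true e′ e P∈ws = subst (λ e″ → cons e″ _ ∈ List.map (cons e′) _)
    (Decidable⇒UIP.≡-irrelevant Bool._≟_ e′ e) (∈-map⁺ (cons e′) P∈ws)
  ∈-extendBy x false e′ e _ with () ← trans (sym e′) e

  walksUpTo-complete : ∀ K {s t} (P : Walk G s t) → len P ≤ K → P ∈ walksUpTo K s t
  walksUpTo-complete zero    nil _ = nil∈trivialWalks _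
  walksUpTo-complete (suc K) nil _ = ∈-++⁺ˡ (nil∈trivialWalks _)
  walksUpTo-complete (suc K) {s} {t} (cons {x = x} e P) (s≤s |P|≤K) = ∈-++⁺ʳ (trivialWalks s t)
    (∈-concatMap⁺ _ (lose (∈-allFin x) (∈-extendBy x (adj G s x) refl e (walksUpTo-complete K P |P|≤K))))

  IsDistK-exists : ∀ K {s t} (Q : Walk G s t) → len Q ≤ K → ∃[ δ ] IsDistK G K s t δ × δ ℚ.≤ ℓ Q
  IsDistK-exists K {s} {t} Q |Q|≤K =
    ℓ M , ((M , argmin-all ℓ |Q|≤K (walksUpTo-sound K s t) , refl) , minimal) ,
    f[argmin]≤v⁺ {f = ℓ} Q (walksUpTo K s t) (inj₁ ℚₚ.≤-refl)
    where
    M : Walk G s t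
    M = argmin ℓ Q (walksUpTo K s t)
    minimal : ∀ P → len P ≤ K → ℓ M ℚ.≤ ℓ P
    minimal P |P|≤K = f[argmin]≤v⁺ {f = ℓ} Q (walksUpTo K s t)
      (inj₂ (Any.map (λ P≡W → ℚₚ.≤-reflexive (cong ℓ (sym P≡W))) (walksUpTo-complete K P |P|≤K)))

module _ {G : Graph} {s : V G} (T : Tree G s) where

  depth≡0⇒root : ∀ y → inT T y → depth T y ≡ 0 → y ≡ s
  depth≡0⇒root y y∈T d≡0 with y ≟ s
  ... | yes y≡s = y≡s
  ... | no y≢s with () ← trans (sym d≡0) (proj₂ (proj₂ (nonroot T y y∈T y≢s)))

  parent-facts : ∀ y → inT T y → 0 < depth T y →
                 inT T (parent T y) × adj G (parent T y) y ≡ true × depth T y ≡ suc (depth T (parent T y))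
  parent-facts y y∈T 0<d = nonroot T y y∈T λ y≡s →
    ℕₚ.<-irrefl (sym (trans (cong (depth T) y≡s) (root-depth T))) 0<d

  private
    climb : ∀ {i} y → inT T y → suc i ≤ depth T y →
            inT T (parent T y) × adj G (parent T y) y ≡ true × i ≤ depth T (parent T y)
    climb {i} y y∈T i<d with parent-facts y y∈T (ℕₚ.<-≤-trans (s≤s z≤n) i<d)
    ... | p∈T , e , dy = p∈T , e , ℕₚ.≤-pred (subst (suc i ≤_) dy i<d)

  parent-anc : ∀ i y → parent T (anc T i y) ≡ anc T (suc i) y
  parent-anc zero    y = refl
  parent-anc (suc i) y = parent-anc i (parent T y)

  anc∈T : ∀ i y → inT T y → i ≤ depth T y → inT T (anc T i y)
  anc∈T zero    y y∈T _   = y∈T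
  anc∈T (suc i) y y∈T i<d with climb y y∈T i<d
  ... | p∈T , _ , i≤dp = anc∈T i (parent T y) p∈T i≤dp

  depth-anc : ∀ i y → inT T y → i ≤ depth T y → depth T (anc T i y) + i ≡ depth T y
  depth-anc zero    y y∈T _   = ℕₚ.+-identityʳ _
  depth-anc (suc i) y y∈T i<d
    with parent-facts y y∈T (ℕₚ.<-≤-trans (s≤s z≤n) i<d) | climb y y∈T i<d
  ... | _ , _ , dy | p∈T , _ , i≤dp =
    trans (ℕₚ.+-suc _ i) (trans (cong suc (depth-anc i (parent T y) p∈T i≤dp)) (sym dy))

  tdist-+ : ∀ i j y → tdist T (i + j) y ≡ tdist T i y ℚ.+ tdist T j (anc T i y)
  tdist-+ zero    j y = sym (ℚₚ.+-identityˡ _)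
  tdist-+ (suc i) j y = trans (cong (w G (parent T y) y ℚ.+_) (tdist-+ i j (parent T y)))
    (sym (ℚₚ.+-assoc (w G (parent T y) y) _ _))

  δT-anc : ∀ i y → inT T y → i ≤ depth T y → δT T y ≡ δT T (anc T i y) ℚ.+ tdist T i y
  δT-anc i y y∈T i≤d = begin
    tdist T (depth T y) y
      ≡⟨ cong (λ m → tdist T m y) (trans (sym (depth-anc i y y∈T i≤d)) (ℕₚ.+-comm _ i)) ⟩
    tdist T (i + depth T (anc T i y)) y
      ≡⟨ tdist-+ i _ y ⟩
    tdist T i y ℚ.+ δT T (anc T i y)
      ≡⟨ ℚₚ.+-comm (tdist T i y) _ ⟩
    δT T (anc T i y) ℚ.+ tdist T i y ∎
    where open ≡-Reasoning

  upPath : ∀ i y → inT T y → i ≤ depth T y → SizedWalk G (anc T i y) y i (tdist T i y)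
  upPath zero y _ _ = record { walk = nil ; |walk| = refl ; ℓ-walk = refl }
  upPath (suc i) y y∈T i<d with climb y y∈T i<d
  ... | p∈T , e , i≤dp = record
    { walk   = walk ++ cons e nil
    ; |walk| = trans (len-++ walk (cons e nil)) (trans (ℕₚ.+-comm _ 1) (cong suc |walk|))
    ; ℓ-walk = trans (ℓ-++ walk (cons e nil))
        (trans (cong₂ ℚ._+_ ℓ-walk (ℚₚ.+-identityʳ (w G (parent T y) y)))
               (ℚₚ.+-comm (tdist T i (parent T y)) _)) }
    where open SizedWalk (upPath i (parent T y) p∈T i≤dp)

  rootPath : ∀ y → inT T y → SizedWalk G s y (depth T y) (δT T y)
  rootPath y y∈T =
    subst (λ a → SizedWalk G a y (depth T y) (δT T y)) top (upPath (depth T y) y y∈T ℕₚ.≤-refl)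
    where
    top : anc T (depth T y) y ≡ s
    top = depth≡0⇒root _ (anc∈T (depth T y) y y∈T ℕₚ.≤-refl)
            (ℕₚ.+-cancelʳ-≡ (depth T y) _ 0 (depth-anc (depth T y) y y∈T ℕₚ.≤-refl))

blocker-above : ∀ {G s} (T : Tree G s) {k B} .{{_ : NonZero k}} → Blocker T k B →
                ∀ m y → inT T y → depth T y ≡ suc m * k → ∃[ i ] i ≤ k × B (anc T i y)
blocker-above {G} T {suc k₁} block m y y∈T dy = block x (anc∈T T k y y∈T k≤dy)
  (c , anc∈T T k₁ y y∈T k₁≤dy , parent-anc T k₁ y , dc) (divides m dx) y y∈T (sym dx+k) refl
  where
  k : ℕ
  k = suc k₁
  x c : V G
  x = anc T k y
  c = anc T k₁ y
  k≤dy : k ≤ depth T y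
  k≤dy = subst (k ≤_) (sym dy) (ℕₚ.m≤m+n k (m * k))
  k₁≤dy : k₁ ≤ depth T y
  k₁≤dy = ℕₚ.≤-trans (ℕₚ.n≤1+n k₁) k≤dy
  dx+k : depth T x + k ≡ depth T y
  dx+k = depth-anc T k y y∈T k≤dy
  dx : depth T x ≡ m * k
  dx = ℕₚ.+-cancelʳ-≡ k _ _ (trans dx+k (trans dy (ℕₚ.+-comm k (m * k))))
  dc : depth T c ≡ suc (depth T x)
  dc = ℕₚ.+-cancelʳ-≡ k₁ _ _
         (trans (depth-anc T k₁ y y∈T k₁≤dy) (trans (sym dx+k) (ℕₚ.+-suc (depth T x) k₁)))

record BlockedRoute (G : Graph) (B : V G → Set) (k : ℕ) (x z : V G) (L : ℚ) : Set where
  field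
    entry exit     : V G
    head           : Walk G x entry
    middle         : Walk G entry exit
    tail           : Walk G exit z
    entry∈B        : B entry
    exit∈B         : B exit
    |head|≤k       : len head ≤ k
    middle-covered : Covered B (2 * k) middle
    |tail|≤2k      : len tail ≤ 2 * k
    ℓ-route        : ℓ head ℚ.+ ℓ middle ℚ.+ ℓ tail ℚ.≤ L

module _ {G : Graph} {B : V G → Set} {k : ℕ} where

  weakenRoute : ∀ {x z L L′} → L ℚ.≤ L′ → BlockedRoute G B k x z L → BlockedRoute G B k x z L′
  weakenRoute L≤L′ ρ = record
    { entry = entry ; exit = exit ; head = head ; middle = middle ; tail = tail
    ; entry∈B = entry∈B ; exit∈B = exit∈B ; |head|≤k = |head|≤k
    ; middle-covered = middle-covered ; |tail|≤2k = |tail|≤2k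
    ; ℓ-route = ℚₚ.≤-trans ℓ-route L≤L′ }
    where open BlockedRoute ρ

  extendRoute : ∀ {x b z L} → BlockedRoute G B k x b L → B b → (U : Walk G b z) → len U ≤ 2 * k →
                BlockedRoute G B k x z (L ℚ.+ ℓ U)
  extendRoute ρ b∈B U |U|≤2k = record
    { entry = entry ; exit = _ ; head = head ; middle = middle ++ tail ; tail = U
    ; entry∈B = entry∈B ; exit∈B = b∈B ; |head|≤k = |head|≤k
    ; middle-covered = Covered-++ middle-covered exit∈B (single tail |tail|≤2k)
    ; |tail|≤2k = |U|≤2k
    ; ℓ-route = ℚₚ.+-monoˡ-≤ (ℓ U) (ℚₚ.≤-trans (ℚₚ.≤-reflexive ℓ-reassoc) ℓ-route) }
    where
    open BlockedRoute ρ
    ℓ-reassoc : ℓ head ℚ.+ ℓ (middle ++ tail) ≡ ℓ head ℚ.+ ℓ middle ℚ.+ ℓ tail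
    ℓ-reassoc = trans (cong (ℓ head ℚ.+_) (ℓ-++ middle tail)) (sym (ℚₚ.+-assoc (ℓ head) _ _))

module _ {G : Graph} {s : V G} (T : Tree G s) (B : V G → Set)
         (k : ℕ) .{{_ : NonZero k}} (block : Blocker T k B) where

  -- r ≤ k rather than r < k: the recursive call, made at the blocker b = anc i (anc r z),
  -- has remainder k ∸ i.
  route : ∀ m r z → r ≤ k → inT T z → depth T z ≡ r + suc m * k → BlockedRoute G B k s z (δT T z)
  routeToBlocker : ∀ m i b → inT T b → B b → i ≤ k → depth T b + i ≡ suc m * k →
                   BlockedRoute G B k s b (δT T b)

  route m r z r≤k z∈T dz = through (blocker-above T {k} {B} block m y y∈T dy)
    where
    r≤dz : r ≤ depth T z
    r≤dz = subst (r ≤_) (sym dz) (ℕₚ.m≤m+n r _)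
    y : V G
    y = anc T r z
    y∈T : inT T y
    y∈T = anc∈T T r z z∈T r≤dz
    dy : depth T y ≡ suc m * k
    dy = ℕₚ.+-cancelʳ-≡ r _ _ (trans (depth-anc T r z z∈T r≤dz) (trans dz (ℕₚ.+-comm r _)))
    module U₂ = SizedWalk (upPath T r z z∈T r≤dz)

    through : ∃[ i ] i ≤ k × B (anc T i y) → BlockedRoute G B k s z (δT T z)
    through (i , i≤k , b∈B) = weakenRoute (ℚₚ.≤-reflexive ℓ-total)
      (extendRoute (routeToBlocker m i b (anc∈T T i y y∈T i≤dy) b∈B i≤k
                                   (trans (depth-anc T i y y∈T i≤dy) dy))
                   b∈B (U₁.walk ++ U₂.walk) |U|≤2k)
      where
      b : V G
      b = anc T i y
      i≤dy : i ≤ depth T y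
      i≤dy = subst (i ≤_) (sym dy) (ℕₚ.≤-trans i≤k (ℕₚ.m≤m+n k _))
      module U₁ = SizedWalk (upPath T i y y∈T i≤dy)
      |U|≤2k : len (U₁.walk ++ U₂.walk) ≤ 2 * k
      |U|≤2k = subst (_≤ 2 * k) (sym (trans (len-++ U₁.walk U₂.walk) (cong₂ _+_ U₁.|walk| U₂.|walk|)))
        (ℕₚ.+-mono-≤ i≤k (ℕₚ.≤-trans r≤k (ℕₚ.m≤m+n k 0)))
      ℓ-total : δT T b ℚ.+ ℓ (U₁.walk ++ U₂.walk) ≡ δT T z
      ℓ-total = begin
        δT T b ℚ.+ ℓ (U₁.walk ++ U₂.walk)
          ≡⟨ cong (δT T b ℚ.+_) (trans (ℓ-++ U₁.walk U₂.walk) (cong₂ ℚ._+_ U₁.ℓ-walk U₂.ℓ-walk)) ⟩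
        δT T b ℚ.+ (tdist T i y ℚ.+ tdist T r z)
          ≡⟨ ℚₚ.+-assoc (δT T b) _ _ ⟨
        δT T b ℚ.+ tdist T i y ℚ.+ tdist T r z
          ≡⟨ cong (ℚ._+ tdist T r z) (δT-anc T i y y∈T i≤dy) ⟨
        δT T y ℚ.+ tdist T r z
          ≡⟨ δT-anc T r z z∈T r≤dz ⟨
        δT T z ∎
        where open ≡-Reasoning

  routeToBlocker zero i b b∈T b∈B i≤k db+i = record
    { entry = b ; exit = b ; head = W.walk ; middle = nil ; tail = nil
    ; entry∈B = b∈B ; exit∈B = b∈B
    ; |head|≤k = subst (_≤ k) (sym W.|walk|)
        (ℕₚ.≤-trans (ℕₚ.m≤m+n _ i) (ℕₚ.≤-reflexive (trans db+i (ℕₚ.+-identityʳ k))))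
    ; middle-covered = single nil z≤n ; |tail|≤2k = z≤n
    ; ℓ-route = ℚₚ.≤-reflexive (trans (trans (ℚₚ.+-identityʳ _) (ℚₚ.+-identityʳ _)) W.ℓ-walk) }
    where module W = SizedWalk (rootPath T b b∈T)
  routeToBlocker (suc m) i b b∈T _ i≤k db+i =
    route m (k ∸ i) b (ℕₚ.m∸n≤m k i) b∈T
      (ℕₚ.+-cancelʳ-≡ i _ _ (trans db+i (trans (cong (_+ suc m * k) (sym (ℕₚ.m∸n+n≡m i≤k)))
                                              (swap (k ∸ i) i (suc m * k)))))
    where
    swap : ∀ a b c → a + b + c ≡ a + c + b
    swap = solve-∀

  blockedRoute : ∀ z → inT T z → k ≤ depth T z → BlockedRoute G B k s z (δT T z)
  blockedRoute z z∈T k≤dz with depth T z / k | m≥n⇒m/n>0 k≤dz | m≡m%n+[m/n]*n (depth T z) k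
  ... | suc m | _ | dz = route m (depth T z % k) z (ℕₚ.<⇒≤ (m%n<n (depth T z) k)) z∈T dz

module _ {G : Graph} (H : V G → Set) (d : ℕ) where

  data Chunked {x v} (R : Walk G x v) : Set where
    whole : len R ≤ 3 * d → Chunked R
    cut   : ∀ {z} (Q : Walk G x z) (R′ : Walk G z v) → 2 * d ≤ len Q → len Q ≤ 3 * d → H z →
            Covered H d R′ → R ≡ Q ++ R′ → Chunked R

  private
    +-≤-3d : ∀ {a b} → a < 2 * d → b ≤ d → a + b ≤ 3 * d
    +-≤-3d a<2d b≤d = ℕₚ.≤-trans (ℕₚ.+-mono-≤ (ℕₚ.<⇒≤ a<2d) b≤d) (ℕₚ.≤-reflexive (2d+d≡3d d))
      where
      2d+d≡3d : ∀ d → 2 * d + d ≡ 3 * d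
      2d+d≡3d = solve-∀

  chunkAfter : ∀ {x y v} (A : Walk G x y) → len A < 2 * d → {R : Walk G y v} →
                Covered H d R → Chunked (A ++ R)
  chunkAfter A |A|<2d (single R |R|≤d) =
    whole (subst (_≤ 3 * d) (sym (len-++ A R)) (+-≤-3d |A|<2d |R|≤d))
  chunkAfter A |A|<2d (split P₁ P₂ |P₁|≤d z∈H cP₂) with 2 * d ≤? len (A ++ P₁)
  ... | yes 2d≤ = cut (A ++ P₁) P₂ 2d≤ (subst (_≤ 3 * d) (sym (len-++ A P₁)) (+-≤-3d |A|<2d |P₁|≤d))
                      z∈H cP₂ (sym (++-assoc A P₁ P₂))
  ... | no 2d≰  = subst Chunked (++-assoc A P₁ P₂) (chunkAfter (A ++ P₁) (ℕₚ.≰⇒> 2d≰) cP₂)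

  chunk : 0 < d → ∀ {x v} {R : Walk G x v} → Covered H d R → Chunked R
  chunk 0<d = chunkAfter nil (ℕₚ.<-≤-trans 0<d (ℕₚ.m≤m+n d _))

module Rerouting
  (G : Graph) (pw : PositiveWeights G) (ε : ℚ) (0≤ε : 0ℚ ℚ.≤ ε)
  (d k : ℕ) .{{_ : NonZero k}} (k*2≡d : k * 2 ≡ d)
  (H B : V G → Set)
  (Tfrom : ∀ x → H x → Tree G x)
  (approx : ∀ x (h : H x) → ApproxSPT G ε (3 * d) x (Tfrom x h))
  (blocks : ∀ x (h : H x) → Blocker (Tfrom x h) k B)
  where

  c : ℚ
  c = 1ℚ ℚ.+ ε

  1≤c : 1ℚ ℚ.≤ c
  1≤c = ℚₚ.≤-trans (ℚₚ.≤-reflexive (sym (ℚₚ.+-identityʳ 1ℚ))) (ℚₚ.+-monoʳ-≤ 1ℚ 0≤ε)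

  0≤c : 0ℚ ℚ.≤ c
  0≤c = ℚₚ.≤-trans (ℚₚ.<⇒≤ (ℚₚ.positive⁻¹ 1ℚ)) 1≤c

  0≤c^ : ∀ j → 0ℚ ℚ.≤ c ^ℚ j
  0≤c^ j = ℚₚ.≤-trans (ℚₚ.<⇒≤ (ℚₚ.positive⁻¹ 1ℚ)) (1≤q^ℚn 1≤c j)

  2k≡d : 2 * k ≡ d
  2k≡d = trans (ℕₚ.*-comm 2 k) k*2≡d

  k≤d : k ≤ d
  k≤d = subst (k ≤_) 2k≡d (ℕₚ.m≤m+n k _)

  0<d : 0 < d
  0<d = ℕₚ.<-≤-trans (ℕ.>-nonZero⁻¹ k) k≤d

  4k≡2d : 4 * k ≡ 2 * d
  4k≡2d = trans (4k≡2[2k] k) (cong (2 *_) 2k≡d)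
    where
    4k≡2[2k] : ∀ k → 4 * k ≡ 2 * (2 * k)
    4k≡2[2k] = solve-∀

  data Shortcut (x z : V G) (L : ℚ) : Set where
    direct      : (W : Walk G x z) → len W < k → ℓ W ℚ.≤ L → Shortcut x z L
    viaBlockers : BlockedRoute G B k x z L → Shortcut x z L

  shortcut : ∀ {x z} → H x → (Q : Walk G x z) → len Q ≤ 3 * d → Shortcut x z (c ℚ.* ℓ Q)
  shortcut {x} {z} h Q |Q|≤3d with IsDistK-exists G (3 * d) Q |Q|≤3d
  ... | δ , δ-isDist , δ≤Q with approx x h z δ δ-isDist
  ... | z∈T , δT≤cδ = viaTree (ℚₚ.≤-trans δT≤cδ (*-monoˡ-≤-0≤ 0≤c δ≤Q))
    where
    T : Tree G x
    T = Tfrom x h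
    viaTree : δT T z ℚ.≤ c ℚ.* ℓ Q → Shortcut x z (c ℚ.* ℓ Q)
    viaTree δT≤cQ with k ≤? depth T z
    ... | yes k≤dz = viaBlockers (weakenRoute δT≤cQ (blockedRoute T B k (blocks x h) z z∈T k≤dz))
    ... | no k≰dz  = direct W.walk (subst (_< k) (sym W.|walk|) (ℕₚ.≰⇒> k≰dz))
                            (subst (ℚ._≤ c ℚ.* ℓ Q) (sym W.ℓ-walk) δT≤cQ)
      where module W = SizedWalk (rootPath T z z∈T)

  Reroutable : ℕ → Set
  Reroutable j = ∀ {a b} (P : Walk G a b) → Covered H d P → len P ≤ 2 ^ j * d →
    Σ[ P′ ∈ Walk G a b ] ℓ P′ ℚ.≤ (c ^ℚ j) ℚ.* ℓ P × Covered B (2 * d * (j + 1)) P′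

  rerouteItself : ∀ j {a b} (P : Walk G a b) → len P ≤ 2 * d * (j + 1) →
    Σ[ P′ ∈ Walk G a b ] ℓ P′ ℚ.≤ (c ^ℚ j) ℚ.* ℓ P × Covered B (2 * d * (j + 1)) P′
  rerouteItself j P |P|≤ = P , p≤q*p (1≤q^ℚn 1≤c j) (0≤ℓ pw P) , single P |P|≤

  d≤2d[j+1] : ∀ j → d ≤ 2 * d * (j + 1)
  d≤2d[j+1] j = ℕₚ.≤-trans (ℕₚ.m≤m+n d _) (ℕₚ.m≤m*n (2 * d) (j + 1) {{ℕ.>-nonZero (ℕₚ.m≤n+m 1 j)}})

  module Step (j : ℕ) (3d≤M : 3 * d ≤ 2 ^ j * d) (IH : Reroutable j) where

    M L : ℕ
    M = 2 ^ j * d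
    L = 2 * d * (j + 1)

    α β : ℚ
    α = c ^ℚ j
    β = c ^ℚ suc j

    2k≤L : 2 * k ≤ L
    2k≤L = subst (_≤ L) (sym 2k≡d) (d≤2d[j+1] j)

    fits : ∀ {s t} → 4 * s ≤ 4 * d + 2 * M → t ≤ k → s + t ≤ M
    fits {s} {t} 4s≤ t≤k = ℕₚ.*-cancelˡ-≤ 4 (begin
      4 * (s + t)           ≡⟨ ℕₚ.*-distribˡ-+ 4 s t ⟩
      4 * s + 4 * t         ≤⟨ ℕₚ.+-mono-≤ 4s≤ (ℕₚ.≤-trans (ℕₚ.*-monoʳ-≤ 4 t≤k) (ℕₚ.≤-reflexive 4k≡2d)) ⟩
      4 * d + 2 * M + 2 * d ≡⟨ rearrange d M ⟩
      2 * (3 * d) + 2 * M   ≤⟨ ℕₚ.+-monoˡ-≤ (2 * M) (ℕₚ.*-monoʳ-≤ 2 3d≤M) ⟩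
      2 * M + 2 * M         ≡⟨ double M ⟩
      4 * M                 ∎)
      where
      open ℕₚ.≤-Reasoning
      rearrange : ∀ d M → 4 * d + 2 * M + 2 * d ≡ 2 * (3 * d) + 2 * M
      rearrange = solve-∀
      double : ∀ M → 2 * M + 2 * M ≡ 4 * M
      double = solve-∀

    suffix-< : ∀ {x z v f} (Q : Walk G x z) (R′ : Walk G z v) → 2 * d ≤ len Q → len (Q ++ R′) ≤ f →
               len R′ < f
    suffix-< Q R′ 2d≤|Q| |QR′|≤f = ℕₚ.<-≤-trans
      (ℕₚ.m<n+m (len R′) (ℕₚ.<-≤-trans (ℕₚ.<-≤-trans 0<d (ℕₚ.m≤m+n d _)) 2d≤|Q|))
      (subst (_≤ _) (len-++ Q R′) |QR′|≤f)

    suffix-≤ : ∀ {x z v m} (Q : Walk G x z) (R′ : Walk G z v) → len (Q ++ R′) ≤ m → len R′ ≤ m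
    suffix-≤ Q R′ |QR′|≤m = ℕₚ.≤-trans (ℕₚ.m≤n+m (len R′) (len Q)) (subst (_≤ _) (len-++ Q R′) |QR′|≤m)

    invariant-direct : ∀ {a x z v} (S : Walk G a x) (T Q : Walk G x z) (R′ : Walk G z v) →
                       len T < k → 2 * d ≤ len Q → 4 * len S + len (Q ++ R′) ≤ 4 * d + 2 * M →
                       4 * len (S ++ T) + len R′ ≤ 4 * d + 2 * M
    invariant-direct S T Q R′ |T|<k 2d≤|Q| inv rewrite len-++ S T | len-++ Q R′ = begin
      4 * (len S + len T) + len R′          ≡⟨ cong (_+ len R′) (ℕₚ.*-distribˡ-+ 4 (len S) (len T)) ⟩
      4 * len S + 4 * len T + len R′        ≡⟨ ℕₚ.+-assoc (4 * len S) (4 * len T) (len R′) ⟩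
      4 * len S + (4 * len T + len R′)      ≤⟨ ℕₚ.+-monoʳ-≤ (4 * len S) (ℕₚ.+-monoˡ-≤ (len R′) 4|T|≤|Q|) ⟩
      4 * len S + (len Q + len R′)          ≤⟨ inv ⟩
      4 * d + 2 * M                         ∎
      where
      open ℕₚ.≤-Reasoning
      4|T|≤|Q| : 4 * len T ≤ len Q
      4|T|≤|Q| = ℕₚ.≤-trans (ℕₚ.*-monoʳ-≤ 4 (ℕₚ.<⇒≤ |T|<k)) (ℕₚ.≤-trans (ℕₚ.≤-reflexive 4k≡2d) 2d≤|Q|)

    invariant-route : ∀ {t r} → t ≤ 2 * k → r ≤ 2 * M → 4 * t + r ≤ 4 * d + 2 * M
    invariant-route {t} t≤2k r≤2M = ℕₚ.+-mono-≤ (ℕₚ.*-monoʳ-≤ 4 (subst (t ≤_) 2k≡d t≤2k)) r≤2M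

    extend : ∀ {a x y} (S : Walk G a x) (X : Walk G x y) → H x → Covered H d S →
             4 * len S ≤ 4 * d + 2 * M → len X ≤ k →
             Σ[ P′ ∈ Walk G a y ] ℓ P′ ℚ.≤ α ℚ.* ℓ S ℚ.+ α ℚ.* ℓ X × Covered B L P′
    extend S X x∈H cS 4S≤ |X|≤k =
      case IH (S ++ X) (Covered-++ cS x∈H (single X (ℕₚ.≤-trans |X|≤k k≤d)))
              (subst (_≤ M) (sym (len-++ S X)) (fits 4S≤ |X|≤k)) of λ where
        (P′ , ℓP′≤ , cP′) → P′ , ℚₚ.≤-trans ℓP′≤ (ℚₚ.≤-reflexive distrib) , cP′
      where
      distrib : α ℚ.* ℓ (S ++ X) ≡ α ℚ.* ℓ S ℚ.+ α ℚ.* ℓ X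
      distrib = trans (cong (α ℚ.*_) (ℓ-++ S X)) (ℚₚ.*-distribˡ-+ α (ℓ S) (ℓ X))

    throughRoute : ∀ {a x z v q r} (S : Walk G a x) → H x → Covered H d S → 4 * len S ≤ 4 * d + 2 * M →
                   (ρ : BlockedRoute G B k x z (c ℚ.* q)) (P₂ : Walk G (BlockedRoute.exit ρ) v) →
                   ℓ P₂ ℚ.≤ α ℚ.* ℓ (BlockedRoute.tail ρ) ℚ.+ r → Covered B L P₂ →
                   Σ[ P′ ∈ Walk G a v ] ℓ P′ ℚ.≤ α ℚ.* ℓ S ℚ.+ β ℚ.* q ℚ.+ r × Covered B L P′
    throughRoute {a} {q = q} {r = r} S x∈H cS 4S≤ ρ P₂ ℓP₂≤ cP₂ =
      case extend S head x∈H cS 4S≤ |head|≤k of λ where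
        (P₁ , ℓP₁≤ , cP₁) → P₁ ++ (middle ++ P₂) , cost P₁ ℓP₁≤ ,
          Covered-++ cP₁ entry∈B (Covered-++ (Covered-mono 2k≤L middle-covered) exit∈B cP₂)
      where
      open BlockedRoute ρ
      u : ℚ
      u = α ℚ.* ℓ S
      cost : (P₁ : Walk G a entry) → ℓ P₁ ℚ.≤ u ℚ.+ α ℚ.* ℓ head →
             ℓ (P₁ ++ (middle ++ P₂)) ℚ.≤ u ℚ.+ β ℚ.* q ℚ.+ r
      cost P₁ ℓP₁≤ = begin
        ℓ (P₁ ++ (middle ++ P₂))
          ≡⟨ trans (ℓ-++ P₁ _) (cong (ℓ P₁ ℚ.+_) (ℓ-++ middle P₂)) ⟩
        ℓ P₁ ℚ.+ (ℓ middle ℚ.+ ℓ P₂)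
          ≤⟨ ℚₚ.+-mono-≤ ℓP₁≤ (ℚₚ.+-mono-≤ (p≤q*p (1≤q^ℚn 1≤c j) (0≤ℓ pw middle)) ℓP₂≤) ⟩
        u ℚ.+ α ℚ.* ℓ head ℚ.+ (α ℚ.* ℓ middle ℚ.+ (α ℚ.* ℓ tail ℚ.+ r))
          ≡⟨ ℚₚ.+-assoc u _ _ ⟩
        u ℚ.+ (α ℚ.* ℓ head ℚ.+ (α ℚ.* ℓ middle ℚ.+ (α ℚ.* ℓ tail ℚ.+ r)))
          ≡⟨ cong (u ℚ.+_) (trans (cong (α ℚ.* ℓ head ℚ.+_) (*-collect α _ _ r)) (*-collect α _ _ r)) ⟩
        u ℚ.+ (α ℚ.* (ℓ head ℚ.+ (ℓ middle ℚ.+ ℓ tail)) ℚ.+ r)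
          ≡⟨ ℚₚ.+-assoc u _ r ⟨
        u ℚ.+ α ℚ.* (ℓ head ℚ.+ (ℓ middle ℚ.+ ℓ tail)) ℚ.+ r
          ≤⟨ ℚₚ.+-monoˡ-≤ r (ℚₚ.+-monoʳ-≤ u (scale-≤ {c = c} {q = q} (0≤c^ j)
               (ℚₚ.≤-trans (ℚₚ.≤-reflexive (sym (ℚₚ.+-assoc (ℓ head) (ℓ middle) (ℓ tail)))) ℓ-route))) ⟩
        u ℚ.+ β ℚ.* q ℚ.+ r ∎
        where open ℚₚ.≤-Reasoning

    record Rerouted {a x v} (S : Walk G a x) (R : Walk G x v) : Set where
      constructor rerouted
      field
        walk    : Walk G a v
        bound   : ℓ walk ℚ.≤ α ℚ.* ℓ S ℚ.+ β ℚ.* ℓ R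
        covered : Covered B L walk

    finishDirect : ∀ {a x v} (S : Walk G a x) {R T : Walk G x v} → H x → Covered H d S →
                   4 * len S ≤ 4 * d + 2 * M → len T < k → ℓ T ℚ.≤ c ℚ.* ℓ R → Rerouted S R
    finishDirect S {R} {T} x∈H cS 4S≤ |T|<k ℓT≤ =
      case extend S T x∈H cS 4S≤ (ℕₚ.<⇒≤ |T|<k) of λ where
        (P′ , ℓP′≤ , cP′) → rerouted P′
          (ℚₚ.≤-trans ℓP′≤ (ℚₚ.+-monoʳ-≤ (α ℚ.* ℓ S) (scale-≤ {c = c} {q = ℓ R} (0≤c^ j) ℓT≤))) cP′

    finishRoute : ∀ {a x v} (S : Walk G a x) {R : Walk G x v} → H x → Covered H d S →
                  4 * len S ≤ 4 * d + 2 * M → BlockedRoute G B k x v (c ℚ.* ℓ R) → Rerouted S R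
    finishRoute S {R} x∈H cS 4S≤ ρ =
      case throughRoute S x∈H cS 4S≤ ρ tail ℓtail≤ (Covered-mono 2k≤L (single tail |tail|≤2k)) of λ where
        (P′ , ℓP′≤ , cP′) → rerouted P′
          (ℚₚ.≤-trans ℓP′≤ (ℚₚ.≤-reflexive (ℚₚ.+-identityʳ (α ℚ.* ℓ S ℚ.+ β ℚ.* ℓ R)))) cP′
      where
      open BlockedRoute ρ
      ℓtail≤ : ℓ tail ℚ.≤ α ℚ.* ℓ tail ℚ.+ 0ℚ
      ℓtail≤ = ℚₚ.≤-trans (p≤q*p (1≤q^ℚn 1≤c j) (0≤ℓ pw tail))
                          (ℚₚ.≤-reflexive (sym (ℚₚ.+-identityʳ (α ℚ.* ℓ tail))))

    continueDirect : ∀ {a x z v} {S : Walk G a x} {T Q : Walk G x z} {R′ : Walk G z v} →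
                     ℓ T ℚ.≤ c ℚ.* ℓ Q → Rerouted (S ++ T) R′ → Rerouted S (Q ++ R′)
    continueDirect {S = S} {T} {Q} {R′} ℓT≤ (rerouted P′ ℓP′≤ cP′) = rerouted P′ cost cP′
      where
      cost : ℓ P′ ℚ.≤ α ℚ.* ℓ S ℚ.+ β ℚ.* ℓ (Q ++ R′)
      cost = begin
        ℓ P′
          ≤⟨ ℓP′≤ ⟩
        α ℚ.* ℓ (S ++ T) ℚ.+ β ℚ.* ℓ R′
          ≡⟨ cong (λ l → α ℚ.* l ℚ.+ β ℚ.* ℓ R′) (ℓ-++ S T) ⟩
        α ℚ.* (ℓ S ℚ.+ ℓ T) ℚ.+ β ℚ.* ℓ R′
          ≡⟨ cong (ℚ._+ β ℚ.* ℓ R′) (ℚₚ.*-distribˡ-+ α (ℓ S) (ℓ T)) ⟩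
        α ℚ.* ℓ S ℚ.+ α ℚ.* ℓ T ℚ.+ β ℚ.* ℓ R′
          ≤⟨ ℚₚ.+-monoˡ-≤ (β ℚ.* ℓ R′) (ℚₚ.+-monoʳ-≤ (α ℚ.* ℓ S) (scale-≤ {c = c} {q = ℓ Q} (0≤c^ j) ℓT≤)) ⟩
        α ℚ.* ℓ S ℚ.+ β ℚ.* ℓ Q ℚ.+ β ℚ.* ℓ R′
          ≡⟨ +-*-collect (α ℚ.* ℓ S) β (ℓ Q) (ℓ R′) ⟩
        α ℚ.* ℓ S ℚ.+ β ℚ.* (ℓ Q ℚ.+ ℓ R′)
          ≡⟨ cong (λ l → α ℚ.* ℓ S ℚ.+ β ℚ.* l) (ℓ-++ Q R′) ⟨
        α ℚ.* ℓ S ℚ.+ β ℚ.* ℓ (Q ++ R′) ∎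
        where open ℚₚ.≤-Reasoning

    continueRoute : ∀ {a x z v} (S : Walk G a x) {Q : Walk G x z} {R′ : Walk G z v} → H x →
                    Covered H d S → 4 * len S ≤ 4 * d + 2 * M → (ρ : BlockedRoute G B k x z (c ℚ.* ℓ Q)) →
                    Rerouted (BlockedRoute.tail ρ) R′ → Rerouted S (Q ++ R′)
    continueRoute S {Q} {R′} x∈H cS 4S≤ ρ (rerouted P₂ ℓP₂≤ cP₂) =
      case throughRoute S x∈H cS 4S≤ ρ P₂ ℓP₂≤ cP₂ of λ where
        (P′ , ℓP′≤ , cP′) → rerouted P′ (ℚₚ.≤-trans ℓP′≤ (ℚₚ.≤-reflexive collect)) cP′
      where
      collect : α ℚ.* ℓ S ℚ.+ β ℚ.* ℓ Q ℚ.+ β ℚ.* ℓ R′ ≡ α ℚ.* ℓ S ℚ.+ β ℚ.* ℓ (Q ++ R′)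
      collect = trans (+-*-collect (α ℚ.* ℓ S) β (ℓ Q) (ℓ R′))
                      (cong (λ l → α ℚ.* ℓ S ℚ.+ β ℚ.* l) (sym (ℓ-++ Q R′)))

    -- Each direct shortcut moves fewer than k = d/2 edges into S while removing at least 2d
    -- edges from R; this keeps 4|S| + |R| ≤ 4d + 2M, which is what fits needs.
    sweep : ∀ f {a x v} (S : Walk G a x) (R : Walk G x v) → H x → Covered H d S → Covered H d R →
            len R < f → 4 * len S + len R ≤ 4 * d + 2 * M → len R ≤ 2 * M → Rerouted S R
    sweep (suc f) S R x∈H cS cR (s≤s |R|≤f) inv |R|≤2M with chunk H d 0<d cR
    ... | whole |R|≤3d with shortcut x∈H R |R|≤3d
    ...   | direct T |T|<k ℓT≤ = finishDirect S x∈H cS (ℕₚ.m+n≤o⇒m≤o _ inv) |T|<k ℓT≤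
    ...   | viaBlockers ρ       = finishRoute S x∈H cS (ℕₚ.m+n≤o⇒m≤o _ inv) ρ
    sweep (suc f) S _ x∈H cS cR (s≤s |R|≤f) inv |R|≤2M
      | cut Q R′ 2d≤|Q| |Q|≤3d z∈H cR′ refl with shortcut x∈H Q |Q|≤3d
    ... | direct T |T|<k ℓT≤ = continueDirect ℓT≤
          (sweep f (S ++ T) R′ z∈H cST cR′ (suffix-< Q R′ 2d≤|Q| |R|≤f)
                 (invariant-direct S T Q R′ |T|<k 2d≤|Q| inv) (suffix-≤ Q R′ |R|≤2M))
      where
      cST : Covered H d (S ++ T)
      cST = Covered-++ cS x∈H (single T (ℕₚ.≤-trans (ℕₚ.<⇒≤ |T|<k) k≤d))
    ... | viaBlockers ρ = continueRoute S x∈H cS (ℕₚ.m+n≤o⇒m≤o _ inv) ρ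
          (sweep f tail R′ z∈H (single tail (subst (len tail ≤_) 2k≡d |tail|≤2k)) cR′
                 (suffix-< Q R′ 2d≤|Q| |R|≤f) (invariant-route |tail|≤2k (suffix-≤ Q R′ |R|≤2M))
                 (suffix-≤ Q R′ |R|≤2M))
      where open BlockedRoute ρ

    rerouteNext : Reroutable (suc j)
    rerouteNext P (single .P |P|≤d) _ = rerouteItself (suc j) P (ℕₚ.≤-trans |P|≤d (d≤2d[j+1] (suc j)))
    rerouteNext .(P₁ ++ P₂) (split P₁ P₂ |P₁|≤d x∈H cP₂) |P|≤ =
      walk , ℚₚ.≤-trans bound cost , Covered-mono (ℕₚ.*-monoʳ-≤ (2 * d) (ℕₚ.n≤1+n (j + 1))) covered
      where
      |P₂|≤2M : len P₂ ≤ 2 * M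
      |P₂|≤2M = ℕₚ.≤-trans (ℕₚ.m≤n+m (len P₂) (len P₁))
        (subst₂ _≤_ (len-++ P₁ P₂) (ℕₚ.*-assoc 2 (2 ^ j) d) |P|≤)
      open Rerouted (sweep (suc (len P₂)) P₁ P₂ x∈H (single P₁ |P₁|≤d) cP₂ ℕₚ.≤-refl
                           (ℕₚ.+-mono-≤ (ℕₚ.*-monoʳ-≤ 4 |P₁|≤d) |P₂|≤2M) |P₂|≤2M)
      cost : α ℚ.* ℓ P₁ ℚ.+ β ℚ.* ℓ P₂ ℚ.≤ β ℚ.* ℓ (P₁ ++ P₂)
      cost = ℚₚ.≤-trans (absorb-≤ {c} {α} {ℓ P₁} {ℓ P₂} 1≤c (0≤c^ j) (0≤ℓ pw P₁))
                        (ℚₚ.≤-reflexive (cong (β ℚ.*_) (sym (ℓ-++ P₁ P₂))))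

  rerouteShort : ∀ j → 2 ^ j ≤ 2 * (j + 1) → Reroutable j
  rerouteShort j 2^j≤ P _ |P|≤ = rerouteItself j P
    (ℕₚ.≤-trans |P|≤ (ℕₚ.≤-trans (ℕₚ.*-monoˡ-≤ d 2^j≤) (ℕₚ.≤-reflexive (rearrange j d))))
    where
    rearrange : ∀ j d → 2 * (j + 1) * d ≡ 2 * d * (j + 1)
    rearrange = solve-∀

  reroutable : ∀ j → Reroutable j
  reroutable 0 = rerouteShort 0 (s≤s z≤n)
  reroutable 1 = rerouteShort 1 (ℕₚ.m≤m+n 2 2)
  reroutable 2 = rerouteShort 2 (ℕₚ.m≤m+n 4 2)
  reroutable (suc j@(suc (suc i))) = Step.rerouteNext j 3d≤M (reroutable j)
    where
    3d≤M : 3 * d ≤ 2 ^ j * d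
    3d≤M = ℕₚ.*-monoˡ-≤ d (ℕₚ.≤-trans (ℕₚ.m≤m+n 3 1) (ℕₚ.*-monoʳ-≤ 2 (ℕₚ.*-monoʳ-≤ 2 (ℕₚ.m^n>0 2 i))))

mainTheorem18 : (G : Graph) → PositiveWeights G → (ε : ℚ) → 0ℚ ℚ.≤ ε →
    (d : ℕ) → 0 < d → 2 ∣ d →
    (H : V G → Set) →
    (Tfrom : ∀ v → H v → Tree G v) → (∀ v (h : H v) → ApproxSPT G ε (3 * d) v (Tfrom v h)) →
    (Tto : ∀ v → H v → Tree (rev G) v) → (∀ v (h : H v) → ApproxSPT (rev G) ε (3 * d) v (Tto v h)) →
    (B : V G → Set) →
    (∀ v (h : H v) → Blocker (Tfrom v h) (d / 2) B × Blocker (Tto v h) (d / 2) B) →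
    ∀ {u v} (P : Walk G u v) → Covered H d P →
    (j : ℕ) → len P ≤ 2 ^ j * d →
    Σ (Walk G u v) λ P′ →
      ℓ P′ ℚ.≤ ((1ℚ ℚ.+ ε) ^ℚ j) ℚ.* ℓ P × Covered B (2 * d * (j + 1)) P′
mainTheorem18 G pw ε 0≤ε d 0<d 2∣d H Tfrom approx _ _ B blockers P cP j =
  Rerouting.reroutable G pw ε 0≤ε d (d / 2) {{d/2≢0}} half*2≡d H B Tfrom approx
                       (λ v h → proj₁ (blockers v h)) j P cP
  where
  half*2≡d : d / 2 * 2 ≡ d
  half*2≡d = m/n*n≡m 2∣d
  d/2≢0 : NonZero (d / 2)
  d/2≢0 = ℕ.≢-nonZero λ d/2≡0 → ℕₚ.<⇒≢ 0<d (trans (sym (cong (_* 2) d/2≡0)) half*2≡d)
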